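{- Let $\Gamma$ be a finite connected simple graph with first Betti number $b$, with the matrices $S^\alpha$ ($\alpha\in\mathrm{Aut}(\Gamma)$) defined relative to a fixed spanning tree $T$, base vertex and cotree arcs $x_1,\dots,x_b$ as in the context, and let $G\le\mathrm{Aut}(\Gamma)$. Suppose $(p;k,l;r_1,\dots,r_l;Q,\omega)$ is a $G$-admissible solution (with $r_i=k$ for $l<i\le b$). (a) If $\sigma\in\Sigma_b$ satisfies $r_{\sigma(i)}=r_i$ for all $i\in\{1,\dots,b\}$, then $(p;k,l;r_1,\dots,r_l;\sigma Q\sigma^{ -1},\sigma\omega)$ is a $G$-admissible solution isomorphic to $(p;k,l;r_1,\dots,r_l;Q,\omega)$. (b) If there exists $\beta\in\mathrm{Aut}(\Gamma)$ with $\beta G\beta^{ -1}=G$ and $S^{\beta}=D\tau$ for some $\tau\in\Sigma_b$ and some diagonal matrix $D$, then there is $Q'$ such that $(p;k,l;r_1,\dots,r_l;Q',\omega\tau)$ is a $G$-admissible solution isomorphic to $(p;k,l;r_1,\dots,r_l;Q,\omega)$.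
   Context: Fix a spanning tree $T$ of $\Gamma$ and a base vertex $v_0$; for each vertex $v$ let $W(v)$ be the unique reduced walk in $T$ from $v_0$ to $v$, and for an arc $(u,v)$ let $L(u,v)=W(u)\cdot(u,v)\cdot W(v)^{ -1}$. Let $e_1,\dots,e_b$ be the cotree edges and choose an arc $x_i$ in $e_i$; then $H_1(\Gamma;\mathbb{Z})$ is free abelian with basis $L(x_1),\dots,L(x_b)$. For $\alpha\in\mathrm{Aut}(\Gamma)$, $S^\alpha\in\mathrm{GL}(b,\mathbb{Z})$ is defined by $\alpha_*(L(x_i))=\sum_j (S^\alpha)_{i,j}L(x_j)$, where $\alpha_*$ is the induced map on $H_1(\Gamma;\mathbb{Z})$; its image in $\mathrm{GL}(b,\mathbb{Z}_{p^k})$ is also denoted $S^\alpha$. A permutation $\tau\in\Sigma_b$ is identified with the permutation matrix $\tau_{i,j}=\delta_{i,\tau(j)}$. For a matrix $U$ over $\mathbb{Z}_{p^k}$, $\langle U\rangle$ is its row space; elements of $\mathbb{Z}_{p^k}$ are identified with representatives in $\{0,\dots,p^k-1\}$. A $G$-admissible solution is a tuple $(p;k,l;r_1,\dots,r_l;Q,\omega)$ with $p$ prime, integers $k\ge1$, $0<l<b$, $0\le r_1\le\cdots\le r_l<k$, $Q\in\mathrm{GL}(b,\mathbb{Z}_{p^k})$, $\omega\in\Sigma_b$, such that (setting $r_i=k$ for $l<i\le b$ and letting $P\in\mathbb{Z}_{p^k}^{l,b}$, $P_{i,j}=\delta_{i,j}p^{r_i}$): $Q$ is upper triangular with diagonal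 entries $1$ and $0\le Q_{i,j}<p^{r_j-r_i}$ for all $i<j$; and $\langle PQ\omega S^\alpha\rangle=\langle PQ\omega\rangle$ for all $\alpha\in G$. Two solutions $(p;k,l;r_1,\dots,r_l;Q,\omega)$ and $(p';k',l';r'_1,\dots,r'_{l'};Q',\omega')$ are isomorphic if $p=p'$, $k=k'$, $l=l'$, $r_i=r'_i$ for all $i$, and $\langle PQ'\omega'\rangle=\langle PQ\omega S^\beta\rangle$ for some $\beta\in\mathrm{Aut}(\Gamma)$. -}

module Defs where

open import Data.Nat as ℕ using (ℕ; zero; suc; _^_; _∸_; _<?_)
open import Data.Nat.Primality using (Prime)
open import Data.Integer as ℤ using (ℤ; +_; _+_; _*_; _-_; -_)
open import Data.Integer.Divisibility using (_∣_)
open import Data.Fin as Fin using (Fin; toℕ; fromℕ<)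
open import Data.Fin.Permutation as Perm using (Permutation′; _⟨$⟩ʳ_; _⟨$⟩ˡ_; _∘ₚ_)
open import Data.Bool using (Bool; true; false; if_then_else_)
open import Data.Product using (Σ; ∃; _×_; _,_; proj₁; proj₂)
open import Data.Sum using (_⊎_)
open import Data.Unit using (⊤)
open import Data.List using (List; []; _∷_; length)
open import Data.List.Relation.Unary.Unique.Propositional using (Unique)
open import Relation.Nullary using (¬_; yes; no)
open import Relation.Nullary.Decidable using (⌊_⌋)
open import Relation.Binary.PropositionalEquality using (_≡_; _≢_)

∑ : ∀ {n} → (Fin n → ℤ) → ℤ
∑ {zero}  f = + 0
∑ {suc n} f = f Fin.zero + ∑ (λ i → f (Fin.suc i))

Mat : ℕ → ℕ → Set
Mat m n = Fin m → Fin n → ℤ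

infixl 7 _⊗_
_⊗_ : ∀ {m n o} → Mat m n → Mat n o → Mat m o
(A ⊗ B) i j = ∑ (λ t → A i t * B t j)

δ : ∀ {m n} → Fin m → Fin n → ℤ
δ i j = if ⌊ toℕ i ℕ.≟ toℕ j ⌋ then + 1 else + 0

I : ∀ {n} → Mat n n
I i j = δ i j

_≋[_]_ : ℤ → ℕ → ℤ → Set
a ≋[ N ] b = (+ N) ∣ (a - b)

-- row space of an m×n matrix over ℤ_N (entries represented by integers)
_∈⟨_⟩[_] : ∀ {m n} → (Fin n → ℤ) → Mat m n → ℕ → Set
_∈⟨_⟩[_] {m} v U N = Σ (Fin m → ℤ) λ c → ∀ j → v j ≋[ N ] ∑ (λ i → c i * U i j)

SameRowSpace : ∀ {m m' n} → ℕ → Mat m n → Mat m' n → Set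
SameRowSpace {n = n} N U V =
  ∀ (v : Fin n → ℤ) → (v ∈⟨ U ⟩[ N ] → v ∈⟨ V ⟩[ N ]) × (v ∈⟨ V ⟩[ N ] → v ∈⟨ U ⟩[ N ])

permMat : ∀ {n} → Permutation′ n → Mat n n
permMat τ i j = δ i (τ ⟨$⟩ʳ j)

-- composition of permutations in the usual (functional) order:
-- (σ · ω)(j) = σ(ω(j)); its permutation matrix is permMat σ ⊗ permMat ω
infixl 9 _·ₚ_
_·ₚ_ : ∀ {n} → Permutation′ n → Permutation′ n → Permutation′ n
σ ·ₚ ω = ω ∘ₚ σ

data Walk {n : ℕ} (A : Fin n → Fin n → Bool) : Fin n → Fin n → Set where
  []   : ∀ {v} → Walk A v v
  step : ∀ {u v} (w : Fin n) → A u w ≡ true → Walk A w v → Walk A u v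

vertices : ∀ {n A u v} → Walk {n} A u v → List (Fin n)
vertices {u = u} []             = u ∷ []
vertices {u = u} (step w _ rest) = u ∷ vertices rest

walkLength : ∀ {n A u v} → Walk {n} A u v → ℕ
walkLength []              = 0
walkLength (step _ _ rest) = suc (walkLength rest)

Reduced : ∀ {n A u v} → Walk {n} A u v → Set
Reduced []                                  = ⊤
Reduced (step w _ [])                       = ⊤
Reduced {u = u} (step w _ (step w' e rest)) = (w' ≢ u) × Reduced (step w' e rest)

dropLast : ∀ {a} {X : Set a} → List X → List X
dropLast []           = []
dropLast (x ∷ [])     = []
dropLast (x ∷ y ∷ xs) = x ∷ dropLast (y ∷ xs)

IsCycle : ∀ {n A v} → Walk {n} A v v → Set
IsCycle c = (3 ℕ.≤ walkLength c) × Unique (dropLast (vertices c))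

Chain : ℕ → Set
Chain n = Fin n → Fin n → ℤ

arcInd : ∀ {n} → Fin n → Fin n → Chain n
arcInd u v a b = δ u a * δ v b

-- chain of an arc (u,v) in C_1: [u,v] = -[v,u]
arcChain : ∀ {n} → Fin n → Fin n → Chain n
arcChain u v a b = arcInd u v a b - arcInd v u a b

chainOf : ∀ {n A u v} → Walk {n} A u v → Chain n
chainOf []                     a b = + 0
chainOf {u = u} (step w _ rest) a b = arcChain u w a b + chainOf rest a b

SameEdge : ∀ {n} → Fin n × Fin n → Fin n × Fin n → Set
SameEdge (u , v) (u' , v') = (u ≡ u' × v ≡ v') ⊎ (u ≡ v' × v ≡ u')

record SimpleGraph : Set where
  field
    n       : ℕ
    adj     : Fin n → Fin n → Bool
    sym     : ∀ u v → adj u v ≡ adj v u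
    irrefl  : ∀ u → adj u u ≡ false

record Aut (Γ : SimpleGraph) : Set where
  open SimpleGraph Γ
  field
    perm      : Permutation′ n
    preserves : ∀ u v → adj (perm ⟨$⟩ʳ u) (perm ⟨$⟩ʳ v) ≡ adj u v

module _ {Γ : SimpleGraph} where
  open SimpleGraph Γ
  open Aut

  _≈ₐ_ : Aut Γ → Aut Γ → Set
  α ≈ₐ β = ∀ u → perm α ⟨$⟩ʳ u ≡ perm β ⟨$⟩ʳ u

  idₐ : Aut Γ
  idₐ = record { perm = Perm.id ; preserves = λ u v → Relation.Binary.PropositionalEquality.refl }

  _∘ₐ_ : Aut Γ → Aut Γ → Aut Γ
  α ∘ₐ β = record
    { perm = perm α ·ₚ perm β
    ; preserves = λ u v → Relation.Binary.PropositionalEquality.trans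
        (preserves α (perm β ⟨$⟩ʳ u) (perm β ⟨$⟩ʳ v)) (preserves β u v) }

  invₐ : Aut Γ → Aut Γ
  invₐ α = record
    { perm = Perm.flip (perm α)
    ; preserves = λ u v → Relation.Binary.PropositionalEquality.trans
        (Relation.Binary.PropositionalEquality.sym (preserves α (perm α ⟨$⟩ˡ u) (perm α ⟨$⟩ˡ v)))
        (Relation.Binary.PropositionalEquality.cong₂ adj (Perm.inverseʳ (perm α)) (Perm.inverseʳ (perm α))) }

  push : Aut Γ → Chain n → Chain n
  push α c a b = c (perm α ⟨$⟩ˡ a) (perm α ⟨$⟩ˡ b)

  record IsSubgroup (G : Aut Γ → Set) : Set where
    field
      respects : ∀ {α β} → α ≈ₐ β → G α → G β
      hasId    : G idₐ
      closed∘  : ∀ {α β} → G α → G β → G (α ∘ₐ β)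
      closedInv : ∀ {α} → G α → G (invₐ α)

  ConjEq : Aut Γ → (Aut Γ → Set) → Set
  ConjEq β G = ∀ γ → (G γ → Σ (Aut Γ) λ α → G α × ((β ∘ₐ α) ∘ₐ invₐ β) ≈ₐ γ)
                   × (Σ (Aut Γ) (λ α → G α × ((β ∘ₐ α) ∘ₐ invₐ β) ≈ₐ γ) → G γ)

record HomologyData (Γ : SimpleGraph) : Set where
  open SimpleGraph Γ
  field
    connected : ∀ u v → Walk adj u v
    -- spanning tree T (as a Boolean adjacency on all vertices)
    T        : Fin n → Fin n → Bool
    T-sym    : ∀ u v → T u v ≡ T v u
    T⊆Γ      : ∀ u v → T u v ≡ true → adj u v ≡ true
    T-conn   : ∀ u v → Walk T u v
    T-acyclic : ∀ v (c : Walk T v v) → ¬ IsCycle c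
    v₀       : Fin n
    W        : ∀ v → Walk T v₀ v
    W-red    : ∀ v → Reduced (W v)
    -- first Betti number b and one arc x_i in each cotree edge e_i
    b        : ℕ
    x        : Fin b → Fin n × Fin n
    x-arc    : ∀ i → adj (proj₁ (x i)) (proj₂ (x i)) ≡ true
    x-cotree : ∀ i → T (proj₁ (x i)) (proj₂ (x i)) ≡ false
    x-inj    : ∀ i j → SameEdge (x i) (x j) → i ≡ j
    x-surj   : ∀ u v → adj u v ≡ true → T u v ≡ false →
               Σ (Fin b) λ i → SameEdge (x i) (u , v)

  -- L(u,v) = W(u)·(u,v)·W(v)⁻¹, as a 1-chain
  L : Fin n → Fin n → Chain n
  L u v a c = chainOf (W u) a c + arcChain u v a c - chainOf (W v) a c

  Lx : Fin b → Chain n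
  Lx i = L (proj₁ (x i)) (proj₂ (x i))

record SMatrices (Γ : SimpleGraph) (H : HomologyData Γ) : Set where
  open SimpleGraph Γ
  open HomologyData H
  field
    S    : Aut Γ → Mat b b
    S-def : ∀ α i a c → push α (Lx i) a c ≡ ∑ (λ j → S α i j * Lx j a c)

module Solutions {Γ : SimpleGraph} (H : HomologyData Γ) (SM : SMatrices Γ H) where
  open SimpleGraph Γ
  open HomologyData H
  open SMatrices SM

  rExt : (k l : ℕ) → (Fin l → ℕ) → Fin b → ℕ
  rExt k l r i with toℕ i <? l
  ... | yes h = r (fromℕ< h)
  ... | no _  = k

  Pmat : (p l : ℕ) → (Fin l → ℕ) → Mat l b
  Pmat p l r i j = δ i j * (+ (p ^ r i))

  IsAdmissible : (G : Aut Γ → Set) (p k l : ℕ) (r : Fin l → ℕ)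
                 (Q : Mat b b) (ω : Permutation′ b) → Set
  IsAdmissible G p k l r Q ω =
      Prime p
    × 1 ℕ.≤ k
    × 0 ℕ.< l × l ℕ.< b
    × (∀ i j → i Fin.≤ j → r i ℕ.≤ r j)
    × (∀ i → r i ℕ.< k)
    × (Σ (Mat b b) λ Q⁻¹ → (∀ i j → (Q ⊗ Q⁻¹) i j ≋[ p ^ k ] I i j)
                         × (∀ i j → (Q⁻¹ ⊗ Q) i j ≋[ p ^ k ] I i j))
    × (∀ i → Q i i ≡ + 1)
    × (∀ i j → j Fin.< i → Q i j ≡ + 0)
    × (∀ i j → i Fin.< j →
         (+ 0 ℤ.≤ Q i j) × (Q i j ℤ.< + (p ^ (rExt k l r j ∸ rExt k l r i))))
    × (∀ α → G α → SameRowSpace (p ^ k) (Pmat p l r ⊗ Q ⊗ permMat ω ⊗ S α)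
                                         (Pmat p l r ⊗ Q ⊗ permMat ω))

  Isomorphic : (p k l : ℕ) (r : Fin l → ℕ)
               (Q : Mat b b) (ω : Permutation′ b) (Q' : Mat b b) (ω' : Permutation′ b) → Set
  Isomorphic p k l r Q ω Q' ω' =
    Σ (Aut Γ) λ β → SameRowSpace (p ^ k) (Pmat p l r ⊗ Q' ⊗ permMat ω')
                                         (Pmat p l r ⊗ Q ⊗ permMat ω ⊗ S β)

  IsDiagonal : Mat b b → Set
  IsDiagonal D = ∀ i j → i ≢ j → D i j ≡ + 0

-- Row spaces are compared after replacing P by the b × b diagonal matrix diag(p^{r_i}): its extra
-- rows are p^k ≡ 0. For (a), σ preserves the exponents, so it commutes with that diagonal matrix
-- and merely permutes the rows of P Q ω; σQσ⁻¹ stays in normal form because an entry that σ moves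
-- below the diagonal lies between indices of equal exponent, where the bound p^(r_j - r_i) = 1
-- forces it to vanish. For (b), S^β = Dτ with D a diagonal matrix of units (S^(β⁻¹) inverts it),
-- so P Q ω S^β = P (Q E) (ω τ) with E diagonal. Then X = E⁻¹ Q E is unitriangular, has the same
-- scaled row space as Q E, and is brought into normal form Q' by the row operations "add a
-- multiple of p^(r_m - r_i) times row m to row i" (m > i), which preserve the row space of
-- diag(p^{r_i}) X. Finally β normalises G, so G-invariance of ⟨P Q ω⟩ passes to ⟨P Q ω S^β⟩,
-- and a unitriangular Q' is automatically invertible.

module Submission where

open import Defs
open import Data.Nat as ℕ using (ℕ; zero; suc; _^_; _∸_; _<?_; NonZero)
import Data.Nat.Properties as ℕP
open import Data.Nat.Primality using (prime⇒nonZero)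
open import Data.Integer as ℤ using (ℤ; +_; _+_; _*_; _-_; -_)
import Data.Integer.Properties as ℤP
import Data.Integer.Divisibility.Signed as Signed
open import Data.Integer.DivMod using (_/ℕ_; _%ℕ_; a≡a%ℕn+[a/ℕn]*n; n%ℕd<d)
open import Data.Integer.Tactic.RingSolver using (solve-∀)
open import Data.Fin as Fin using (Fin; zero; suc; toℕ; fromℕ<; inject≤)
import Data.Fin.Properties as FinP
open import Data.Fin.Permutation as Perm using (Permutation′; _⟨$⟩ʳ_; _⟨$⟩ˡ_; flip)
open import Data.Bool using (false)
open import Data.Vec.Functional using (_∷_)
open import Data.Product using (Σ; _×_; _,_; proj₁; proj₂)
open import Data.Sum using (inj₁; inj₂)
open import Relation.Nullary using (¬_; Dec; yes; no; contradiction)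
open import Relation.Binary.Definitions using (tri<; tri≈; tri>)
open import Relation.Binary.PropositionalEquality
open import Function using (_∘_)
import Algebra.Properties.Semiring.Sum ℤP.+-*-semiring as Sum

-- Finite sums and matrices over ℤ

∑≡sum : ∀ {n} (f : Fin n → ℤ) → ∑ f ≡ Sum.sum f
∑≡sum {zero}  f = refl
∑≡sum {suc n} f = cong (_+_ (f zero)) (∑≡sum (λ i → f (suc i)))

∑-cong : ∀ {n} {f g : Fin n → ℤ} → (∀ i → f i ≡ g i) → ∑ f ≡ ∑ g
∑-cong {f = f} {g} f≗g = trans (∑≡sum f) (trans (Sum.sum-cong-≗ {_} {f} {g} f≗g) (sym (∑≡sum g)))

∑-zero : ∀ {n} {f : Fin n → ℤ} → (∀ i → f i ≡ + 0) → ∑ f ≡ + 0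
∑-zero {zero}  f≗0 = refl
∑-zero {suc n} f≗0 = cong₂ _+_ (f≗0 zero) (∑-zero (f≗0 ∘ suc))

∑-distrib-+ : ∀ {n} (f g : Fin n → ℤ) → ∑ (λ i → f i + g i) ≡ ∑ f + ∑ g
∑-distrib-+ f g = trans (∑≡sum (λ i → f i + g i))
  (trans (Sum.∑-distrib-+ f g) (sym (cong₂ _+_ (∑≡sum f) (∑≡sum g))))

*-distribˡ-∑ : ∀ {n} c (f : Fin n → ℤ) → c * ∑ f ≡ ∑ (λ i → c * f i)
*-distribˡ-∑ c f = trans (cong (c *_) (∑≡sum f))
  (trans (Sum.*-distribˡ-sum c f) (sym (∑≡sum (λ i → c * f i))))

*-distribʳ-∑ : ∀ {n} c (f : Fin n → ℤ) → ∑ f * c ≡ ∑ (λ i → f i * c)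
*-distribʳ-∑ c f = trans (cong (_* c) (∑≡sum f))
  (trans (Sum.*-distribʳ-sum c f) (sym (∑≡sum (λ i → f i * c))))

∑-comm : ∀ {m n} (f : Fin m → Fin n → ℤ) →
         ∑ (λ i → ∑ (λ j → f i j)) ≡ ∑ (λ j → ∑ (λ i → f i j))
∑-comm f = begin
  ∑ (λ i → ∑ (f i))                  ≡⟨ ∑-cong (λ i → ∑≡sum (f i)) ⟩
  ∑ (λ i → Sum.sum (f i))            ≡⟨ ∑≡sum (λ i → Sum.sum (f i)) ⟩
  Sum.sum (λ i → Sum.sum (f i))      ≡⟨ Sum.∑-comm f ⟩
  Sum.sum (λ j → Sum.sum (λ i → f i j)) ≡⟨ sym (∑≡sum (λ j → Sum.sum (λ i → f i j))) ⟩
  ∑ (λ j → Sum.sum (λ i → f i j))    ≡⟨ sym (∑-cong (λ j → ∑≡sum (λ i → f i j))) ⟩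
  ∑ (λ j → ∑ (λ i → f i j))          ∎
  where open ≡-Reasoning

∑-single : ∀ {n} {f : Fin n → ℤ} i → (∀ j → j ≢ i → f j ≡ + 0) → ∑ f ≡ f i
∑-single {suc n} {f} zero f≗0 =
  trans (cong (_+_ (f zero)) (∑-zero (λ j → f≗0 (suc j) λ ()))) (ℤP.+-identityʳ _)
∑-single {suc n} {f} (suc i) f≗0 =
  trans (cong (_+ ∑ (λ j → f (suc j))) (f≗0 zero λ ()))
  (trans (ℤP.+-identityˡ _) (∑-single i (λ j j≢i → f≗0 (suc j) (j≢i ∘ FinP.suc-injective))))

∑-neg : ∀ {n} (f : Fin n → ℤ) → ∑ (λ i → - f i) ≡ - ∑ f
∑-neg f = trans (∑-cong (λ i → sym (ℤP.-1*i≡-i (f i))))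
  (trans (sym (*-distribˡ-∑ (ℤ.-[1+ 0 ]) f)) (ℤP.-1*i≡-i (∑ f)))

δ-≡ : ∀ {m n} {i : Fin m} {j : Fin n} → toℕ i ≡ toℕ j → δ i j ≡ + 1
δ-≡ {i = i} {j} i≡j with toℕ i ℕ.≟ toℕ j
... | yes _  = refl
... | no i≢j = contradiction i≡j i≢j

δ-≢ : ∀ {m n} {i : Fin m} {j : Fin n} → toℕ i ≢ toℕ j → δ i j ≡ + 0
δ-≢ {i = i} {j} i≢j with toℕ i ℕ.≟ toℕ j
... | yes i≡j = contradiction i≡j i≢j
... | no _    = refl

δ-diag : ∀ {n} (i : Fin n) → δ i i ≡ + 1
δ-diag i = δ-≡ refl

δ-offDiag : ∀ {n} {i j : Fin n} → i ≢ j → δ i j ≡ + 0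
δ-offDiag i≢j = δ-≢ (i≢j ∘ FinP.toℕ-injective)

δ-suc : ∀ {m n} (i : Fin m) (j : Fin n) → δ (suc i) (suc j) ≡ δ i j
δ-suc i j with toℕ i ℕ.≟ toℕ j
... | yes i≡j = δ-≡ (cong suc i≡j)
... | no i≢j  = δ-≢ (i≢j ∘ ℕP.suc-injective)

∑-δ : ∀ {m n} (i : Fin m) (t₀ : Fin n) → toℕ t₀ ≡ toℕ i →
      (f : Fin n → ℤ) → ∑ (λ t → δ i t * f t) ≡ f t₀
∑-δ i t₀ t₀≡i f = begin
  ∑ (λ t → δ i t * f t) ≡⟨ ∑-single t₀ (λ t t≢t₀ → cong (_* f t) (δ-≢ (t≢t₀ ∘ sym-toℕ))) ⟩
  δ i t₀ * f t₀         ≡⟨ cong (_* f t₀) (δ-≡ (sym t₀≡i)) ⟩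
  + 1 * f t₀            ≡⟨ ℤP.*-identityˡ (f t₀) ⟩
  f t₀                  ∎
  where
  open ≡-Reasoning
  sym-toℕ : ∀ {t} → toℕ i ≡ toℕ t → t ≡ t₀
  sym-toℕ i≡t = FinP.toℕ-injective (trans (sym i≡t) (sym t₀≡i))

∑-δˡ : ∀ {n} (i : Fin n) (f : Fin n → ℤ) → ∑ (λ t → δ i t * f t) ≡ f i
∑-δˡ i = ∑-δ i i refl

∑-δʳ : ∀ {n} (j : Fin n) (f : Fin n → ℤ) → ∑ (λ t → f t * δ t j) ≡ f j
∑-δʳ j f = begin
  ∑ (λ t → f t * δ t j) ≡⟨ ∑-single j (λ t t≢j → trans (cong (f t *_) (δ-offDiag t≢j)) (ℤP.*-zeroʳ (f t))) ⟩
  f j * δ j j           ≡⟨ cong (f j *_) (δ-diag j) ⟩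
  f j * + 1             ≡⟨ ℤP.*-identityʳ (f j) ⟩
  f j                   ∎
  where open ≡-Reasoning

⊗-assoc : ∀ {m n o q} (A : Mat m n) (B : Mat n o) (C : Mat o q) i j →
          ((A ⊗ B) ⊗ C) i j ≡ (A ⊗ (B ⊗ C)) i j
⊗-assoc A B C i j = begin
  ∑ (λ t → ∑ (λ s → A i s * B s t) * C t j) ≡⟨ ∑-cong (λ t → *-distribʳ-∑ (C t j) (λ s → A i s * B s t)) ⟩
  ∑ (λ t → ∑ (λ s → A i s * B s t * C t j)) ≡⟨ ∑-comm (λ t s → A i s * B s t * C t j) ⟩
  ∑ (λ s → ∑ (λ t → A i s * B s t * C t j)) ≡⟨ ∑-cong (λ s → ∑-cong (λ t → ℤP.*-assoc (A i s) (B s t) (C t j))) ⟩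
  ∑ (λ s → ∑ (λ t → A i s * (B s t * C t j))) ≡⟨ ∑-cong (λ s → sym (*-distribˡ-∑ (A i s) (λ t → B s t * C t j))) ⟩
  ∑ (λ s → A i s * ∑ (λ t → B s t * C t j)) ∎
  where open ≡-Reasoning

⊗-identityʳ : ∀ {m n} (A : Mat m n) i j → (A ⊗ I) i j ≡ A i j
⊗-identityʳ A i j = ∑-δʳ j (A i)

⊗-permMat : ∀ {m n} (M : Mat m n) (π : Permutation′ n) i j → (M ⊗ permMat π) i j ≡ M i (π ⟨$⟩ʳ j)
⊗-permMat M π i j = ∑-δʳ (π ⟨$⟩ʳ j) (M i)

permMat-⊗ : ∀ {m n} (π : Permutation′ m) (M : Mat m n) i j → (permMat π ⊗ M) i j ≡ M (π ⟨$⟩ˡ i) j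
permMat-⊗ π M i j = begin
  ∑ (λ t → δ i (π ⟨$⟩ʳ t) * M t j) ≡⟨ ∑-single (π ⟨$⟩ˡ i) (λ t t≢ → cong (_* M t j) (δ-offDiag (t≢ ∘ π⁻¹-solve))) ⟩
  δ i (π ⟨$⟩ʳ (π ⟨$⟩ˡ i)) * M (π ⟨$⟩ˡ i) j ≡⟨ cong (λ s → δ i s * M (π ⟨$⟩ˡ i) j) (Perm.inverseʳ π) ⟩
  δ i i * M (π ⟨$⟩ˡ i) j ≡⟨ cong (_* M (π ⟨$⟩ˡ i) j) (δ-diag i) ⟩
  + 1 * M (π ⟨$⟩ˡ i) j ≡⟨ ℤP.*-identityˡ _ ⟩
  M (π ⟨$⟩ˡ i) j ∎
  where
  open ≡-Reasoning
  π⁻¹-solve : ∀ {t} → i ≡ π ⟨$⟩ʳ t → t ≡ π ⟨$⟩ˡ i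
  π⁻¹-solve refl = sym (Perm.inverseˡ π)

conjugate-entries : ∀ {n} (σ : Permutation′ n) (A : Mat n n) i j →
                    (permMat σ ⊗ A ⊗ permMat (flip σ)) i j ≡ A (σ ⟨$⟩ˡ i) (σ ⟨$⟩ˡ j)
conjugate-entries σ A i j = trans (⊗-permMat (permMat σ ⊗ A) (flip σ) i j) (permMat-⊗ σ A i (σ ⟨$⟩ˡ j))

module _ {n} {D : Mat n n} (D-diagonal : ∀ i j → i ≢ j → D i j ≡ + 0) where

  diagonal-⊗ : ∀ {m} (B : Mat n m) i j → (D ⊗ B) i j ≡ D i i * B i j
  diagonal-⊗ B i j = ∑-single i (λ t t≢i → trans (cong (_* B t j) (D-diagonal i t (t≢i ∘ sym))) (ℤP.*-zeroˡ (B t j)))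

  ⊗-diagonal : ∀ {m} (B : Mat m n) i j → (B ⊗ D) i j ≡ B i j * D j j
  ⊗-diagonal B i j = ∑-single j (λ t t≢j → trans (cong (B i t *_) (D-diagonal t j t≢j)) (ℤP.*-zeroʳ (B i t)))

⊗-congʳ : ∀ {m n o} (A : Mat m n) {B C : Mat n o} → (∀ i j → B i j ≡ C i j) → ∀ i j → (A ⊗ B) i j ≡ (A ⊗ C) i j
⊗-congʳ A B≗C i j = ∑-cong (λ t → cong (A i t *_) (B≗C t j))

⊗-congˡ : ∀ {m n o} {A B : Mat m n} (C : Mat n o) → (∀ i j → A i j ≡ B i j) → ∀ i j → (A ⊗ C) i j ≡ (B ⊗ C) i j
⊗-congˡ C A≗B i j = ∑-cong (λ t → cong (_* C t j) (A≗B i t))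

scaleRows : ∀ {m n} → (Fin m → ℤ) → Mat m n → Mat m n
scaleRows v M i j = v i * M i j

scaleColumns : ∀ {m n} → Mat m n → (Fin n → ℤ) → Mat m n
scaleColumns M v i j = M i j * v j

conjugate-scaleRows : ∀ {n} (σ ω : Permutation′ n) (v : Fin n → ℤ) → (∀ i → v (σ ⟨$⟩ʳ i) ≡ v i) →
  (Q : Mat n n) → ∀ i j → (scaleRows v (permMat σ ⊗ Q ⊗ permMat (flip σ)) ⊗ permMat (σ ·ₚ ω)) i j
                          ≡ (scaleRows v Q ⊗ permMat ω) (σ ⟨$⟩ˡ i) j
conjugate-scaleRows σ ω v σ-preserves Q i j = begin
  (scaleRows v (permMat σ ⊗ Q ⊗ permMat (flip σ)) ⊗ permMat (σ ·ₚ ω)) i j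
    ≡⟨ ⊗-permMat (scaleRows v (permMat σ ⊗ Q ⊗ permMat (flip σ))) (σ ·ₚ ω) i j ⟩
  v i * (permMat σ ⊗ Q ⊗ permMat (flip σ)) i (σ ⟨$⟩ʳ (ω ⟨$⟩ʳ j)) ≡⟨ cong (v i *_) (conjugate-entries σ Q i _) ⟩
  v i * Q (σ ⟨$⟩ˡ i) (σ ⟨$⟩ˡ (σ ⟨$⟩ʳ (ω ⟨$⟩ʳ j)))               ≡⟨ cong₂ (λ a c → a * Q (σ ⟨$⟩ˡ i) c) v-σˡ (Perm.inverseˡ σ) ⟩
  v (σ ⟨$⟩ˡ i) * Q (σ ⟨$⟩ˡ i) (ω ⟨$⟩ʳ j)                        ≡⟨ ⊗-permMat (scaleRows v Q) ω (σ ⟨$⟩ˡ i) j ⟨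
  (scaleRows v Q ⊗ permMat ω) (σ ⟨$⟩ˡ i) j                     ∎
  where
  open ≡-Reasoning
  v-σˡ : v i ≡ v (σ ⟨$⟩ˡ i)
  v-σˡ = trans (cong v (sym (Perm.inverseʳ σ))) (σ-preserves (σ ⟨$⟩ˡ i))

-- ω D = E ω for the diagonal matrix E = diag(D (ω⁻¹ u) (ω⁻¹ u)).
permMat-monomial : ∀ {m n} {D : Mat n n} → (∀ i j → i ≢ j → D i j ≡ + 0) → (A : Mat m n) (ω τ : Permutation′ n) →
  ∀ i j → (A ⊗ permMat ω ⊗ (D ⊗ permMat τ)) i j
          ≡ (scaleColumns A (λ u → D (ω ⟨$⟩ˡ u) (ω ⟨$⟩ˡ u)) ⊗ permMat (ω ·ₚ τ)) i j
permMat-monomial {D = D} D-diagonal A ω τ i j = begin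
  (A ⊗ permMat ω ⊗ (D ⊗ permMat τ)) i j  ≡⟨ ⊗-assoc (A ⊗ permMat ω) D (permMat τ) i j ⟨
  (A ⊗ permMat ω ⊗ D ⊗ permMat τ) i j    ≡⟨ ⊗-permMat (A ⊗ permMat ω ⊗ D) τ i j ⟩
  (A ⊗ permMat ω ⊗ D) i τj               ≡⟨ ⊗-diagonal D-diagonal (A ⊗ permMat ω) i τj ⟩
  (A ⊗ permMat ω) i τj * D τj τj         ≡⟨ cong₂ (λ a s → a * D s s) (⊗-permMat A ω i τj) (sym (Perm.inverseˡ ω)) ⟩
  A i (ω ⟨$⟩ʳ τj) * D (ω ⟨$⟩ˡ (ω ⟨$⟩ʳ τj)) (ω ⟨$⟩ˡ (ω ⟨$⟩ʳ τj)) ≡⟨ ⊗-permMat (scaleColumns A _) (ω ·ₚ τ) i j ⟨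
  (scaleColumns A (λ u → D (ω ⟨$⟩ˡ u) (ω ⟨$⟩ˡ u)) ⊗ permMat (ω ·ₚ τ)) i j ∎
  where
  open ≡-Reasoning
  τj = τ ⟨$⟩ʳ j

-- Congruences and row spaces modulo N

-- A record wrapper around `_≋[_]_`, so that both sides are inferable from its type.
record _≡_mod_ (a b : ℤ) (N : ℕ) : Set where
  constructor divides-difference
  field difference : (+ N) Signed.∣ (a - b)

infix 4 _≡_mod_

module Congruence {N : ℕ} where

  fromDefs : ∀ {a b} → a ≋[ N ] b → a ≡ b mod N
  fromDefs = divides-difference ∘ Signed.∣ᵤ⇒∣

  toDefs : ∀ {a b} → a ≡ b mod N → a ≋[ N ] b
  toDefs = Signed.∣⇒∣ᵤ ∘ _≡_mod_.difference

  mod-reflexive : ∀ {a b} → a ≡ b → a ≡ b mod N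
  mod-reflexive {a} refl = divides-difference (Signed.divides (+ 0) (ℤP.+-inverseʳ a))

  mod-sym : ∀ {a b} → a ≡ b mod N → b ≡ a mod N
  mod-sym {a} {b} (divides-difference N∣a-b) =
    divides-difference (subst (Signed._∣_ (+ N)) (negate-difference a b) (Signed.∣m⇒∣-m N∣a-b))
    where
    negate-difference : ∀ a b → - (a - b) ≡ b - a
    negate-difference = solve-∀

  mod-+ : ∀ {a b c d} → a ≡ b mod N → c ≡ d mod N → a + c ≡ b + d mod N
  mod-+ {a} {b} {c} {d} (divides-difference N∣a-b) (divides-difference N∣c-d) =
    divides-difference (subst (Signed._∣_ (+ N)) (sum-of-differences a b c d) (Signed.∣m∣n⇒∣m+n N∣a-b N∣c-d))
    where
    sum-of-differences : ∀ a b c d → (a - b) + (c - d) ≡ (a + c) - (b + d)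
    sum-of-differences = solve-∀

  mod-trans : ∀ {a b c} → a ≡ b mod N → b ≡ c mod N → a ≡ c mod N
  mod-trans {a} {b} {c} (divides-difference N∣a-b) (divides-difference N∣b-c) =
    divides-difference (subst (Signed._∣_ (+ N)) (telescope a b c) (Signed.∣m∣n⇒∣m+n N∣a-b N∣b-c))
    where
    telescope : ∀ a b c → (a - b) + (b - c) ≡ a - c
    telescope = solve-∀

  mod-*ˡ : ∀ c {a b} → a ≡ b mod N → c * a ≡ c * b mod N
  mod-*ˡ c {a} {b} (divides-difference N∣a-b) =
    divides-difference (subst (Signed._∣_ (+ N)) (distrib c a b) (Signed.∣n⇒∣m*n c N∣a-b))
    where
    distrib : ∀ c a b → c * (a - b) ≡ c * a - c * b
    distrib = solve-∀

  mod-*ʳ : ∀ c {a b} → a ≡ b mod N → a * c ≡ b * c mod N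
  mod-*ʳ c {a} {b} a≡b = subst₂ (λ x y → x ≡ y mod N) (ℤP.*-comm c a) (ℤP.*-comm c b) (mod-*ˡ c a≡b)

  multiple-mod : ∀ a → + N * a ≡ + 0 mod N
  multiple-mod a = divides-difference (Signed.divides a (trans (ℤP.+-identityʳ (+ N * a)) (ℤP.*-comm (+ N) a)))

  mod-∑ : ∀ {n} {f g : Fin n → ℤ} → (∀ i → f i ≡ g i mod N) → ∑ f ≡ ∑ g mod N
  mod-∑ {zero}  f≡g = mod-reflexive refl
  mod-∑ {suc n} f≡g = mod-+ (f≡g zero) (mod-∑ (f≡g ∘ suc))

module RowSpace (N : ℕ) where
  open Congruence {N}

  infix 4 _∈span_ _≅_

  -- `v ∈⟨ U ⟩[ N ]` with its witness wrapped in a record, so that v and U are inferable.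
  record _∈span_ {m n} (v : Fin n → ℤ) (U : Mat m n) : Set where
    constructor combination
    field
      coefficient : Fin m → ℤ
      expansion   : ∀ j → v j ≡ ∑ (λ i → coefficient i * U i j) mod N

  _≅_ : ∀ {m m' n} → Mat m n → Mat m' n → Set
  U ≅ V = SameRowSpace N U V

  ∈-row : ∀ {m n} (U : Mat m n) i → U i ∈span U
  ∈-row U i = combination (δ i) λ j → mod-reflexive (sym (∑-δˡ i (λ t → U t j)))

  ∈-resp : ∀ {m n} {U : Mat m n} {v w : Fin n → ℤ} →
           (∀ j → v j ≡ w j mod N) → v ∈span U → w ∈span U
  ∈-resp v≡w (combination c v≡cU) = combination c λ j → mod-trans (mod-sym (v≡w j)) (v≡cU j)

  ∈-zero : ∀ {m n} {U : Mat m n} {v : Fin n → ℤ} → (∀ j → v j ≡ + 0 mod N) → v ∈span U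
  ∈-zero {U = U} v≡0 = combination (λ _ → + 0) λ j →
    mod-trans (v≡0 j) (mod-reflexive (sym (∑-zero (λ t → ℤP.*-zeroˡ (U t j)))))

  ∈-lincomb : ∀ {m m' n} {U : Mat m n} {W : Mat m' n} → (∀ i → W i ∈span U) →
              (c : Fin m' → ℤ) → (λ j → ∑ (λ i → c i * W i j)) ∈span U
  ∈-lincomb {U = U} {W} W⊆U c = combination (λ t → ∑ (λ i → c i * d i t)) λ j → mod-trans
      (mod-∑ (λ i → mod-*ˡ (c i) (_∈span_.expansion (W⊆U i) j)))
      (mod-reflexive (sym (⊗-assoc (λ (_ : Fin 1) → c) d U zero j)))
    where
    d : Mat _ _
    d i = _∈span_.coefficient (W⊆U i)

  ∈-trans : ∀ {m m' n} {U : Mat m n} {W : Mat m' n} {v : Fin n → ℤ} →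
            v ∈span W → (∀ i → W i ∈span U) → v ∈span U
  ∈-trans (combination c v≡cW) W⊆U = ∈-resp (λ j → mod-sym (v≡cW j)) (∈-lincomb W⊆U c)

  ∈-+ : ∀ {m n} {U : Mat m n} {v w : Fin n → ℤ} →
        v ∈span U → w ∈span U → (λ j → v j + w j) ∈span U
  ∈-+ {U = U} (combination c v≡cU) (combination d w≡dU) = combination (λ i → c i + d i) λ j →
    mod-trans (mod-+ (v≡cU j) (w≡dU j))
      (mod-reflexive (sym (trans (∑-cong (λ i → ℤP.*-distribʳ-+ (U i j) (c i) (d i)))
                                 (∑-distrib-+ (λ i → c i * U i j) (λ i → d i * U i j)))))

  ∈-scale : ∀ {m n} {U : Mat m n} {v : Fin n → ℤ} →
            (a : ℤ) → v ∈span U → (λ j → a * v j) ∈span U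
  ∈-scale {U = U} a (combination c v≡cU) = combination (λ i → a * c i) λ j →
    mod-trans (mod-*ˡ a (v≡cU j))
      (mod-reflexive (trans (*-distribˡ-∑ a (λ i → c i * U i j))
                            (∑-cong (λ i → sym (ℤP.*-assoc a (c i) (U i j))))))

  ∈-⊗ʳ : ∀ {m n o} {U : Mat m n} {v : Fin n → ℤ} → v ∈span U →
         (R : Mat n o) → (λ j → ∑ (λ t → v t * R t j)) ∈span U ⊗ R
  ∈-⊗ʳ {U = U} (combination c v≡cU) R = combination c λ j → mod-trans
    (mod-∑ (λ t → mod-*ʳ (R t j) (v≡cU t)))
    (mod-reflexive (⊗-assoc (λ (_ : Fin 1) → c) U R zero j))

  ∈⟨⟩⇒∈span : ∀ {m n} (U : Mat m n) {v : Fin n → ℤ} → v ∈⟨ U ⟩[ N ] → v ∈span U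
  ∈⟨⟩⇒∈span U (c , v≡cU) = combination c (fromDefs ∘ v≡cU)

  ∈span⇒∈⟨⟩ : ∀ {m n} {U : Mat m n} {v : Fin n → ℤ} → v ∈span U → v ∈⟨ U ⟩[ N ]
  ∈span⇒∈⟨⟩ (combination c v≡cU) = c , toDefs ∘ v≡cU

  ≅-intro : ∀ {m m' n} {U : Mat m n} {V : Mat m' n} →
            (∀ i → U i ∈span V) → (∀ i → V i ∈span U) → U ≅ V
  ≅-intro {U = U} {V} U⊆V V⊆U v = (λ v∈U → ∈span⇒∈⟨⟩ (∈-trans (∈⟨⟩⇒∈span U {v} v∈U) U⊆V))
                                , (λ v∈V → ∈span⇒∈⟨⟩ (∈-trans (∈⟨⟩⇒∈span V {v} v∈V) V⊆U))

  ≅-rows : ∀ {m m' n} {U : Mat m n} {V : Mat m' n} → U ≅ V → ∀ i → U i ∈span V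
  ≅-rows {U = U} {V} U≅V i = ∈⟨⟩⇒∈span V {U i} (proj₁ (U≅V (U i)) (∈span⇒∈⟨⟩ (∈-row U i)))

  ≅-refl : ∀ {m n} {U : Mat m n} → U ≅ U
  ≅-refl v = (λ v∈U → v∈U) , (λ v∈U → v∈U)

  ≅-sym : ∀ {m m' n} {U : Mat m n} {V : Mat m' n} → U ≅ V → V ≅ U
  ≅-sym U≅V v = proj₂ (U≅V v) , proj₁ (U≅V v)

  ≅-trans : ∀ {m m' m'' n} {U : Mat m n} {V : Mat m' n} {W : Mat m'' n} → U ≅ V → V ≅ W → U ≅ W
  ≅-trans U≅V V≅W v = proj₁ (V≅W v) ∘ proj₁ (U≅V v) , proj₂ (U≅V v) ∘ proj₂ (V≅W v)

  ≅-pointwise : ∀ {m n} {U V : Mat m n} → (∀ i j → U i j ≡ V i j) → U ≅ V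
  ≅-pointwise {U = U} {V} U≗V =
    ≅-intro (λ i → ∈-resp (λ j → mod-reflexive (sym (U≗V i j))) (∈-row V i))
            (λ i → ∈-resp (λ j → mod-reflexive (U≗V i j)) (∈-row U i))

  ≅-⊗ʳ : ∀ {m m' n o} {U : Mat m n} {V : Mat m' n} → U ≅ V → (R : Mat n o) → U ⊗ R ≅ V ⊗ R
  ≅-⊗ʳ U≅V R = ≅-intro (λ i → ∈-⊗ʳ (≅-rows U≅V i) R) (λ i → ∈-⊗ʳ (≅-rows (≅-sym U≅V) i) R)

  ≅-permuteRows : ∀ {m n} (π : Permutation′ m) (U : Mat m n) → (λ i → U (π ⟨$⟩ʳ i)) ≅ U
  ≅-permuteRows π U = ≅-intro (λ i → ∈-row U (π ⟨$⟩ʳ i))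
    (λ i → ∈-resp (λ j → mod-reflexive (cong (λ s → U s j) (Perm.inverseʳ π))) (∈-row _ (π ⟨$⟩ˡ i)))

  ≅-rescaleRows : ∀ {m n} (A : Mat m n) (u v : Fin m → ℤ) → (∀ i → v i * u i ≡ + 1) →
                  (λ i j → u i * A i j) ≅ A
  ≅-rescaleRows A u v vu≡1 = ≅-intro (λ i → ∈-scale (u i) (∈-row A i))
    (λ i → ∈-resp (λ j → mod-reflexive (cancel i j)) (∈-scale (v i) (∈-row (λ i j → u i * A i j) i)))
    where
    cancel : ∀ i j → v i * (u i * A i j) ≡ A i j
    cancel i j = trans (sym (ℤP.*-assoc (v i) (u i) (A i j))) (trans (cong (_* A i j) (vu≡1 i)) (ℤP.*-identityˡ (A i j)))

-- Unitriangular matrices and their normal forms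

record Unitriangular {n} (A : Mat n n) : Set where
  field
    diagonal : ∀ i → A i i ≡ + 1
    lower    : ∀ i j → j Fin.< i → A i j ≡ + 0

open Unitriangular

block : ∀ {n} → ℤ → (Fin n → ℤ) → (Fin n → ℤ) → Mat n n → Mat (suc n) (suc n)
block a r c M zero    zero    = a
block a r c M zero    (suc j) = r j
block a r c M (suc i) zero    = c i
block a r c M (suc i) (suc j) = M i j

lowerRight : ∀ {n} → Mat (suc n) (suc n) → Mat n n
lowerRight A i j = A (suc i) (suc j)

lowerRight-unitriangular : ∀ {n} {A : Mat (suc n) (suc n)} → Unitriangular A → Unitriangular (lowerRight A)
lowerRight-unitriangular A-ut = record
  { diagonal = diagonal A-ut ∘ suc
  ; lower    = λ i j j<i → lower A-ut (suc i) (suc j) (ℕ.s<s j<i) }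

firstColumn-zero : ∀ {n} {A : Mat (suc n) (suc n)} → Unitriangular A → ∀ i → A (suc i) zero ≡ + 0
firstColumn-zero A-ut i = lower A-ut (suc i) zero (ℕ.s≤s ℕ.z≤n)

*-zeroʳ² : ∀ a b → a * (b * + 0) ≡ + 0
*-zeroʳ² a b = trans (cong (a *_) (ℤP.*-zeroʳ b)) (ℤP.*-zeroʳ a)

∑-*-zeroʳ : ∀ {n} (f : Fin n → ℤ) → ∑ (λ t → f t * + 0) ≡ + 0
∑-*-zeroʳ f = ∑-zero (λ t → ℤP.*-zeroʳ (f t))

unitriangular-inverse : ∀ {n} (A : Mat n n) → Unitriangular A →
  Σ (Mat n n) λ W → (∀ i j → (A ⊗ W) i j ≡ I i j) × (∀ i j → (W ⊗ A) i j ≡ I i j)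
unitriangular-inverse {zero}  A A-ut = A , (λ ()) , (λ ())
unitriangular-inverse {suc n} A A-ut = W , A⊗W≡I , W⊗A≡I
  where
  A₀ = lowerRight A
  inverse₀ = unitriangular-inverse A₀ (lowerRight-unitriangular A-ut)
  W₀ = proj₁ inverse₀
  a : Fin n → ℤ
  a = A zero ∘ suc
  W : Mat (suc n) (suc n)
  W = block (+ 1) (λ j → - ∑ (λ t → a t * W₀ t j)) (λ _ → + 0) W₀
  A⊗W≡I : ∀ i j → (A ⊗ W) i j ≡ I i j
  A⊗W≡I zero    zero    rewrite diagonal A-ut zero | ∑-*-zeroʳ a = refl
  A⊗W≡I zero    (suc j) rewrite diagonal A-ut zero = cancel (∑ (λ t → a t * W₀ t j))
    where cancel : ∀ s → + 1 * - s + s ≡ + 0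
          cancel = solve-∀
  A⊗W≡I (suc i) zero    rewrite firstColumn-zero A-ut i | ∑-*-zeroʳ (A₀ i) = refl
  A⊗W≡I (suc i) (suc j) rewrite firstColumn-zero A-ut i =
    trans (ℤP.+-identityˡ _) (trans (proj₁ (proj₂ inverse₀) i j) (sym (δ-suc i j)))
  firstColumn-annihilates : ∀ f → ∑ (λ t → f t * A (suc t) zero) ≡ + 0
  firstColumn-annihilates f = ∑-zero (λ t → trans (cong (f t *_) (firstColumn-zero A-ut t)) (ℤP.*-zeroʳ (f t)))
  W⊗A≡I : ∀ i j → (W ⊗ A) i j ≡ I i j
  W⊗A≡I zero    zero    rewrite diagonal A-ut zero = cong (_+_ (+ 1)) (firstColumn-annihilates (W zero ∘ suc))
  W⊗A≡I zero    (suc j) = begin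
    + 1 * a j + ∑ (λ t → - ∑ (λ s → a s * W₀ s t) * A₀ t j)
      ≡⟨ cong (_+_ (+ 1 * a j)) (trans (∑-cong (λ t → sym (ℤP.neg-distribˡ-* (∑ (λ s → a s * W₀ s t)) (A₀ t j))))
                                        (∑-neg (λ t → ∑ (λ s → a s * W₀ s t) * A₀ t j))) ⟩
    + 1 * a j - ∑ (λ t → ∑ (λ s → a s * W₀ s t) * A₀ t j)
      ≡⟨ cong (λ z → + 1 * a j - z) (⊗-assoc (λ (_ : Fin 1) → a) W₀ A₀ zero j) ⟩
    + 1 * a j - ∑ (λ s → a s * (W₀ ⊗ A₀) s j)
      ≡⟨ cong (λ z → + 1 * a j - z) (trans (∑-cong (λ s → cong (a s *_) (proj₂ (proj₂ inverse₀) s j))) (∑-δʳ j a)) ⟩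
    + 1 * a j - a j
      ≡⟨ cancel (a j) ⟩
    + 0 ∎
    where
    open ≡-Reasoning
    cancel : ∀ s → + 1 * s - s ≡ + 0
    cancel = solve-∀
  W⊗A≡I (suc i) zero    = trans (ℤP.+-identityˡ _) (firstColumn-annihilates (W₀ i))
  W⊗A≡I (suc i) (suc j) = trans (ℤP.+-identityˡ _) (trans (proj₂ (proj₂ inverse₀) i j) (sym (δ-suc i j)))

record Normalised (p : ℕ) {n} (e : Fin n → ℕ) (Q : Mat n n) : Set where
  field
    unitriangular : Unitriangular Q
    bounded       : ∀ i j → i Fin.< j → (+ 0 ℤ.≤ Q i j) × (Q i j ℤ.< + (p ^ (e j ∸ e i)))

normalised-resp : ∀ {p n} {e : Fin n → ℕ} {A B : Mat n n} → (∀ i j → A i j ≡ B i j) →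
                  Normalised p e A → Normalised p e B
normalised-resp {p} {e = e} A≗B A-normalised = record
  { unitriangular = record
    { diagonal = λ i → trans (sym (A≗B i i)) (diagonal unitriangular i)
    ; lower    = λ i j j<i → trans (sym (A≗B i j)) (lower unitriangular i j j<i) }
  ; bounded = λ i j i<j → subst (λ q → (+ 0 ℤ.≤ q) × (q ℤ.< + (p ^ (e j ∸ e i)))) (A≗B i j) (bounded i j i<j) }
  where open Normalised A-normalised

rescale-unitriangular : ∀ {n} {Q : Mat n n} → Unitriangular Q → (w e : Fin n → ℤ) → (∀ i → w i * e i ≡ + 1) →
                        Unitriangular (λ i j → w i * (Q i j * e j))
rescale-unitriangular Q-ut w e we≡1 = record
  { diagonal = λ i → trans (cong (λ q → w i * (q * e i)) (diagonal Q-ut i))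
                           (trans (cong (w i *_) (ℤP.*-identityˡ (e i))) (we≡1 i))
  ; lower    = λ i j j<i → trans (cong (λ q → w i * (q * e j)) (lower Q-ut i j j<i)) (ℤP.*-zeroʳ (w i)) }

module Normalisation (p : ℕ) .{{p≢0 : NonZero p}} where

  pow : ℕ → ℤ
  pow e = + (p ^ e)

  pow-split : ∀ {a b} → a ℕ.≤ b → pow a * pow (b ∸ a) ≡ pow b
  pow-split {a} {b} a≤b = trans (sym (ℤP.pos-* (p ^ a) (p ^ (b ∸ a))))
    (cong +_ (trans (sym (ℕP.^-distribˡ-+-* p a (b ∸ a))) (cong (p ^_) (ℕP.m+[n∸m]≡n a≤b))))

  addRows : ∀ {m n} → (Fin n → ℤ) → (Fin m → ℤ) → Mat m n → Fin n → ℤ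
  addRows x c B j = x j + ∑ (λ i → c i * B i j)

  -- Euclidean division by p^(f j), column by column from the left, against the rows of a
  -- unitriangular matrix scaled by p^(f m).
  reduceRow : ∀ {n} (Q : Mat n n) → Unitriangular Q → (f : Fin n → ℕ) (x : Fin n → ℤ) →
              Σ (Fin n → ℤ) λ c → ∀ j → let y = addRows x c (scaleRows (pow ∘ f) Q) j in
                                          (+ 0 ℤ.≤ y) × (y ℤ.< pow (f j))
  reduceRow {zero}  Q Q-ut f x = (λ ()) , λ ()
  reduceRow {suc n} Q Q-ut f x = c , inRange
    where
    instance
      d≢0 : NonZero (p ^ f zero)
      d≢0 = ℕP.m^n≢0 p (f zero)
    d = p ^ f zero
    c₀ : ℤ
    c₀ = - (x zero /ℕ d)
    x' : Fin n → ℤ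
    x' j = x (suc j) + c₀ * (pow (f zero) * Q zero (suc j))
    rest = reduceRow (lowerRight Q) (lowerRight-unitriangular Q-ut) (f ∘ suc) x'
    c : Fin (suc n) → ℤ
    c = c₀ ∷ proj₁ rest
    y = addRows x c (scaleRows (pow ∘ f) Q)
    y-zero : y zero ≡ + (x zero %ℕ d)
    y-zero = begin
      x zero + (c₀ * (pow (f zero) * Q zero zero) + ∑ (λ m → proj₁ rest m * (pow (f (suc m)) * Q (suc m) zero)))
        ≡⟨ cong₂ (λ a s → x zero + (c₀ * (pow (f zero) * a) + s)) (diagonal Q-ut zero)
                 (∑-zero (λ m → trans (cong (λ a → proj₁ rest m * (pow (f (suc m)) * a)) (firstColumn-zero Q-ut m))
                                      (*-zeroʳ² (proj₁ rest m) (pow (f (suc m)))))) ⟩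
      x zero + (c₀ * (pow (f zero) * + 1) + + 0)
        ≡⟨ cong (λ a → a + (c₀ * (pow (f zero) * + 1) + + 0)) (a≡a%ℕn+[a/ℕn]*n (x zero) d) ⟩
      (+ (x zero %ℕ d) + (x zero /ℕ d) * + d) + (- (x zero /ℕ d) * (+ d * + 1) + + 0)
        ≡⟨ cancel (+ (x zero %ℕ d)) (x zero /ℕ d) (+ d) ⟩
      + (x zero %ℕ d) ∎
      where
      open ≡-Reasoning
      cancel : ∀ r q d → (r + q * d) + (- q * (d * + 1) + + 0) ≡ r
      cancel = solve-∀
    y-suc : ∀ j → y (suc j) ≡ addRows x' (proj₁ rest) (scaleRows (pow ∘ f ∘ suc) (lowerRight Q)) j
    y-suc j = sym (ℤP.+-assoc (x (suc j)) _ _)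
    inRange : ∀ j → (+ 0 ℤ.≤ y j) × (y j ℤ.< pow (f j))
    inRange zero    rewrite y-zero = ℤ.+≤+ ℕ.z≤n , ℤ.+<+ (n%ℕd<d (x zero) d)
    inRange (suc j) rewrite y-suc j = proj₂ rest j

  module _ (N : ℕ) where
    open RowSpace N
    open Congruence {N}

    ∈-zeroExtend : ∀ {m n} {U : Mat (suc m) (suc n)} {V : Mat m n} {v : Fin n → ℤ} →
                   (∀ i j → U (suc i) j ≡ (+ 0 ∷ V i) j) → v ∈span V → (+ 0 ∷ v) ∈span U
    ∈-zeroExtend {U = U} {V} {v} tail≡ (combination c v≡cV) = combination (+ 0 ∷ c) expansion
      where
      tail-sum : ∀ j → ∑ (λ i → c i * U (suc i) j) ≡ ∑ (λ i → c i * (+ 0 ∷ V i) j)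
      tail-sum j = ∑-cong (λ i → cong (c i *_) (tail≡ i j))
      expansion : ∀ j → (+ 0 ∷ v) j ≡ ∑ (λ i → (+ 0 ∷ c) i * U i j) mod N
      expansion zero    = mod-reflexive (sym (trans (ℤP.+-identityˡ _) (trans (tail-sum zero) (∑-*-zeroʳ c))))
      expansion (suc j) = mod-trans (v≡cV j) (mod-reflexive (sym (trans (ℤP.+-identityˡ _) (tail-sum (suc j)))))

    normalise : ∀ {n} (e : Fin n → ℕ) → (∀ i j → i Fin.≤ j → e i ℕ.≤ e j) →
             (X : Mat n n) → Unitriangular X →
             Σ (Mat n n) λ Q → Normalised p e Q × scaleRows (pow ∘ e) Q ≅ scaleRows (pow ∘ e) X
    normalise {zero}  e e-mono X X-ut =
      X , record { unitriangular = X-ut ; bounded = λ () } , ≅-refl {U = scaleRows (pow ∘ e) X}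
    normalise {suc n} e e-mono X X-ut = Q , Q-normalised , ≅-intro Q⊆X X⊆Q
      where
      e₀ = e ∘ suc
      rest = normalise e₀ (λ i j i≤j → e-mono (suc i) (suc j) (ℕ.s≤s i≤j)) (lowerRight X) (lowerRight-unitriangular X-ut)
      Q₀ = proj₁ rest
      module Q₀ = Normalised (proj₁ (proj₂ rest))
      x : Fin n → ℤ
      x = X zero ∘ suc
      row = reduceRow Q₀ Q₀.unitriangular (λ m → e₀ m ∸ e zero) x
      c = proj₁ row
      y = addRows x c (scaleRows (λ m → pow (e₀ m ∸ e zero)) Q₀)
      Q : Mat (suc n) (suc n)
      Q = block (+ 1) y (λ _ → + 0) Q₀
      Q-normalised : Normalised p e Q
      Q-normalised = record
        { unitriangular = record { diagonal = diagonal′ ; lower = lower′ } ; bounded = bounded′ }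
        where
        diagonal′ : ∀ i → Q i i ≡ + 1
        diagonal′ zero    = refl
        diagonal′ (suc i) = diagonal Q₀.unitriangular i
        lower′ : ∀ i j → j Fin.< i → Q i j ≡ + 0
        lower′ (suc i) zero    _   = refl
        lower′ (suc i) (suc j) j<i = lower Q₀.unitriangular i j (ℕ.s<s⁻¹ j<i)
        bounded′ : ∀ i j → i Fin.< j → (+ 0 ℤ.≤ Q i j) × (Q i j ℤ.< pow (e j ∸ e i))
        bounded′ zero    (suc j) _   = proj₂ row j
        bounded′ (suc i) (suc j) i<j = Q₀.bounded i j (ℕ.s<s⁻¹ i<j)
      sQ = scaleRows (pow ∘ e) Q
      sX = scaleRows (pow ∘ e) X
      tailQ : ∀ i j → sQ (suc i) j ≡ (+ 0 ∷ scaleRows (pow ∘ e₀) Q₀ i) j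
      tailQ i zero    = ℤP.*-zeroʳ (pow (e₀ i))
      tailQ i (suc j) = refl
      tailX : ∀ i j → sX (suc i) j ≡ (+ 0 ∷ scaleRows (pow ∘ e₀) (lowerRight X) i) j
      tailX i zero    = trans (cong (pow (e₀ i) *_) (firstColumn-zero X-ut i)) (ℤP.*-zeroʳ (pow (e₀ i)))
      tailX i (suc j) = refl
      tailQ⊆X : ∀ i → sQ (suc i) ∈span sX
      tailQ⊆X i = ∈-resp (λ j → mod-reflexive (sym (tailQ i j))) (∈-zeroExtend tailX (≅-rows (proj₂ (proj₂ rest)) i))
      tailX⊆Q : ∀ i → sX (suc i) ∈span sQ
      tailX⊆Q i = ∈-resp (λ j → mod-reflexive (sym (tailX i j))) (∈-zeroExtend tailQ (≅-rows (≅-sym (proj₂ (proj₂ rest))) i))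
      firstRow : ∀ j → sQ zero j ≡ sX zero j + ∑ (λ m → c m * sQ (suc m) j)
      firstRow zero    = trans (sym (ℤP.+-identityʳ _))
        (cong₂ _+_ (cong (pow (e zero) *_) (sym (diagonal X-ut zero)))
                   (sym (∑-zero (λ m → *-zeroʳ² (c m) (pow (e₀ m))))))
      firstRow (suc j) = begin
        pow (e zero) * (x j + ∑ (λ m → c m * (pow (e₀ m ∸ e zero) * Q₀ m j)))
          ≡⟨ ℤP.*-distribˡ-+ (pow (e zero)) (x j) _ ⟩
        pow (e zero) * x j + pow (e zero) * ∑ (λ m → c m * (pow (e₀ m ∸ e zero) * Q₀ m j))
          ≡⟨ cong (_+_ (pow (e zero) * x j))
                  (trans (*-distribˡ-∑ (pow (e zero)) (λ m → c m * (pow (e₀ m ∸ e zero) * Q₀ m j))) (∑-cong merge)) ⟩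
        pow (e zero) * x j + ∑ (λ m → c m * (pow (e₀ m) * Q₀ m j)) ∎
        where
        open ≡-Reasoning
        reassociate : ∀ a c b q → a * (c * (b * q)) ≡ c * ((a * b) * q)
        reassociate = solve-∀
        merge : ∀ m → pow (e zero) * (c m * (pow (e₀ m ∸ e zero) * Q₀ m j)) ≡ c m * (pow (e₀ m) * Q₀ m j)
        merge m = trans (reassociate (pow (e zero)) (c m) (pow (e₀ m ∸ e zero)) (Q₀ m j))
          (cong (λ a → c m * (a * Q₀ m j)) (pow-split (e-mono zero (suc m) ℕ.z≤n)))
      Q⊆X : ∀ i → sQ i ∈span sX
      Q⊆X zero    = ∈-resp (λ j → mod-reflexive (sym (firstRow j))) (∈-+ (∈-row sX zero) (∈-lincomb tailQ⊆X c))
      Q⊆X (suc i) = tailQ⊆X i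
      X⊆Q : ∀ i → sX i ∈span sQ
      X⊆Q zero    = ∈-resp (λ j → mod-reflexive (undo j)) (∈-+ (∈-row sQ zero) (∈-lincomb (∈-row sQ ∘ suc) (λ m → - c m)))
        where
        undo : ∀ j → sQ zero j + ∑ (λ m → - c m * sQ (suc m) j) ≡ sX zero j
        undo j = begin
          sQ zero j + ∑ (λ m → - c m * sQ (suc m) j)
            ≡⟨ cong₂ _+_ (firstRow j) (trans (∑-cong (λ m → sym (ℤP.neg-distribˡ-* (c m) (sQ (suc m) j))))
                                              (∑-neg (λ m → c m * sQ (suc m) j))) ⟩
          (sX zero j + ∑ (λ m → c m * sQ (suc m) j)) - ∑ (λ m → c m * sQ (suc m) j)
            ≡⟨ cancel (sX zero j) (∑ (λ m → c m * sQ (suc m) j)) ⟩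
          sX zero j ∎
          where
          open ≡-Reasoning
          cancel : ∀ a s → (a + s) - s ≡ a
          cancel = solve-∀
      X⊆Q (suc i) = tailX⊆Q i

module _ {p n} {e : Fin n → ℕ} {Q : Mat n n} (Q-normalised : Normalised p e Q) where
  open Normalised Q-normalised

  -- The bound p^(e c ∸ e a) collapses to 1 when e c ≤ e a.
  normalised-offDiagonal : ∀ {a c} → a ≢ c → e c ℕ.≤ e a → Q a c ≡ + 0
  normalised-offDiagonal {a} {c} a≢c ec≤ea with FinP.<-cmp a c
  ... | tri< a<c _ _ = non-negative-below-one (proj₁ (bounded a c a<c))
                         (subst (λ z → Q a c ℤ.< + (p ^ z)) (ℕP.m≤n⇒m∸n≡0 ec≤ea) (proj₂ (bounded a c a<c)))
    where
    non-negative-below-one : ∀ {q} → + 0 ℤ.≤ q → q ℤ.< + 1 → q ≡ + 0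
    non-negative-below-one (ℤ.+≤+ ℕ.z≤n) (ℤ.+<+ (ℕ.s≤s ℕ.z≤n)) = refl
  ... | tri≈ _ a≡c _ = contradiction a≡c a≢c
  ... | tri> _ _ c<a = lower unitriangular a c c<a

  normalised-conjugate : .{{_ : NonZero p}} → (∀ i j → i Fin.≤ j → e i ℕ.≤ e j) →
    (σ : Permutation′ n) → (∀ i → e (σ ⟨$⟩ʳ i) ≡ e i) →
    Normalised p e (λ i j → Q (σ ⟨$⟩ˡ i) (σ ⟨$⟩ˡ j))
  normalised-conjugate e-mono σ σ-preserves = record
    { unitriangular = record { diagonal = diagonal unitriangular ∘ σˡ ; lower = lower′ }
    ; bounded       = bounded′ }
    where
    σˡ = σ ⟨$⟩ˡ_
    e-σˡ : ∀ i → e (σˡ i) ≡ e i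
    e-σˡ i = trans (sym (σ-preserves (σˡ i))) (cong e (Perm.inverseʳ σ))
    σˡ-injective : ∀ {i j} → σˡ i ≡ σˡ j → i ≡ j
    σˡ-injective {i} {j} σˡi≡σˡj = trans (sym (Perm.inverseʳ σ)) (trans (cong (σ ⟨$⟩ʳ_) σˡi≡σˡj) (Perm.inverseʳ σ))
    lower′ : ∀ i j → j Fin.< i → Q (σˡ i) (σˡ j) ≡ + 0
    lower′ i j j<i = normalised-offDiagonal (λ σˡi≡σˡj → FinP.<⇒≢ j<i (sym (σˡ-injective σˡi≡σˡj)))
                       (subst₂ ℕ._≤_ (sym (e-σˡ j)) (sym (e-σˡ i)) (e-mono j i (ℕP.<⇒≤ j<i)))
    bounded′ : ∀ i j → i Fin.< j → (+ 0 ℤ.≤ Q (σˡ i) (σˡ j)) × (Q (σˡ i) (σˡ j) ℤ.< + (p ^ (e j ∸ e i)))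
    bounded′ i j i<j with FinP.<-cmp (σˡ i) (σˡ j)
    ... | tri< σˡi<σˡj _ _ = subst (λ z → (+ 0 ℤ.≤ Q (σˡ i) (σˡ j)) × (Q (σˡ i) (σˡ j) ℤ.< + (p ^ z)))
                                   (cong₂ _∸_ (e-σˡ j) (e-σˡ i)) (bounded (σˡ i) (σˡ j) σˡi<σˡj)
    ... | tri≈ _ σˡi≡σˡj _ = contradiction (σˡ-injective σˡi≡σˡj) (FinP.<⇒≢ i<j)
    ... | tri> _ _ σˡj<σˡi rewrite lower unitriangular (σˡ i) (σˡ j) σˡj<σˡi =
      ℤ.+≤+ ℕ.z≤n , ℤ.+<+ (ℕP.m^n>0 p (e j ∸ e i))

-- The matrices S^α

module HomologyMatrices {Γ : SimpleGraph} (H : HomologyData Γ) (SM : SMatrices Γ H) where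
  open SimpleGraph Γ hiding (sym)
  open HomologyData H
  open SMatrices SM

  arcInd-other : ∀ {u w a c : Fin n} → ¬ (u ≡ a × w ≡ c) → arcInd u w a c ≡ + 0
  arcInd-other {u} {w} {a} {c} ≢arc with u Fin.≟ a | w Fin.≟ c
  ... | no u≢a | _       = cong (_* δ w c) (δ-offDiag u≢a)
  ... | yes _  | no w≢c  = trans (cong (δ u a *_) (δ-offDiag w≢c)) (ℤP.*-zeroʳ (δ u a))
  ... | yes u≡a | yes w≡c = contradiction (u≡a , w≡c) ≢arc

  treeWalk-cotree : ∀ {u v} (w : Walk T u v) a c → T a c ≡ false → chainOf w a c ≡ + 0
  treeWalk-cotree []                a c _     = refl
  treeWalk-cotree {u} (step w Tuw rest) a c Tac≡false
    rewrite treeWalk-cotree rest a c Tac≡false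
          | arcInd-other {u} {w} {a} {c} (λ { (refl , refl) → contradiction (trans (sym Tac≡false) Tuw) λ () })
          | arcInd-other {w} {u} {a} {c} (λ { (refl , refl) → contradiction (trans (sym Tac≡false) (trans (T-sym w u) Tuw)) λ () })
    = refl

  arc-not-loop : ∀ i → proj₂ (x i) ≢ proj₁ (x i)
  arc-not-loop i x₂≡x₁ =
    contradiction (trans (sym (irrefl (proj₁ (x i)))) (trans (cong (adj (proj₁ (x i))) (sym x₂≡x₁)) (x-arc i))) λ ()

  -- The arcs x₁ … x_b are dual to the basis L(x₁) … L(x_b): tree walks never use a cotree arc.
  Lx-at-arc : ∀ j i → Lx j (proj₁ (x i)) (proj₂ (x i)) ≡ δ j i
  Lx-at-arc j i
    rewrite treeWalk-cotree (W (proj₁ (x j))) (proj₁ (x i)) (proj₂ (x i)) (x-cotree i)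
          | treeWalk-cotree (W (proj₂ (x j))) (proj₁ (x i)) (proj₂ (x i)) (x-cotree i)
    with j Fin.≟ i
  ... | yes refl
    rewrite δ-diag (proj₁ (x i)) | δ-diag (proj₂ (x i)) | δ-diag i
          | arcInd-other {proj₂ (x i)} {proj₁ (x i)} {proj₁ (x i)} {proj₂ (x i)} (arc-not-loop i ∘ proj₁)
    = refl
  ... | no j≢i
    rewrite arcInd-other {proj₁ (x j)} {proj₂ (x j)} {proj₁ (x i)} {proj₂ (x i)} (j≢i ∘ x-inj j i ∘ inj₁)
          | arcInd-other {proj₂ (x j)} {proj₁ (x j)} {proj₁ (x i)} {proj₂ (x i)} (λ (e₂ , e₁) → j≢i (x-inj j i (inj₂ (e₁ , e₂))))
          | δ-offDiag j≢i
    = refl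

  S-at-arc : ∀ α i j → S α i j ≡ push α (Lx i) (proj₁ (x j)) (proj₂ (x j))
  S-at-arc α i j = sym (begin
    push α (Lx i) (proj₁ (x j)) (proj₂ (x j))         ≡⟨ S-def α i (proj₁ (x j)) (proj₂ (x j)) ⟩
    ∑ (λ t → S α i t * Lx t (proj₁ (x j)) (proj₂ (x j))) ≡⟨ ∑-cong (λ t → cong (S α i t *_) (Lx-at-arc t j)) ⟩
    ∑ (λ t → S α i t * δ t j)                          ≡⟨ ∑-δʳ j (S α i) ⟩
    S α i j                                            ∎)
    where open ≡-Reasoning

  S-id : ∀ i j → S idₐ i j ≡ I i j
  S-id i j = trans (S-at-arc idₐ i j) (Lx-at-arc i j)

  ⊗-S-id : ∀ {m} (A : Mat m b) i j → (A ⊗ S idₐ) i j ≡ A i j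
  ⊗-S-id A i j = trans (⊗-congʳ A S-id i j) (⊗-identityʳ A i j)

  S-cong : ∀ {α β : Aut Γ} → α ≈ₐ β → ∀ i j → S α i j ≡ S β i j
  S-cong {α} {β} α≈β i j = trans (S-at-arc α i j)
    (trans (cong₂ (Lx i) (inverse-cong (proj₁ (x j))) (inverse-cong (proj₂ (x j)))) (sym (S-at-arc β i j)))
    where
    inverse-cong : ∀ u → Aut.perm α ⟨$⟩ˡ u ≡ Aut.perm β ⟨$⟩ˡ u
    inverse-cong u = trans (cong (Aut.perm α ⟨$⟩ˡ_) (sym (trans (α≈β (Aut.perm β ⟨$⟩ˡ u)) (Perm.inverseʳ (Aut.perm β)))))
                           (Perm.inverseˡ (Aut.perm α))

  S-∘ₐ : ∀ α β i j → S (α ∘ₐ β) i j ≡ (S β ⊗ S α) i j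
  S-∘ₐ α β i j = trans (S-at-arc (α ∘ₐ β) i j)
    (trans (S-def β i (Aut.perm α ⟨$⟩ˡ proj₁ (x j)) (Aut.perm α ⟨$⟩ˡ proj₂ (x j)))
           (∑-cong (λ t → cong (S β i t *_) (sym (S-at-arc α t j)))))

-- Admissible solutions

module Admissibility {Γ : SimpleGraph} (H : HomologyData Γ) (SM : SMatrices Γ H) where
  open SimpleGraph Γ hiding (sym)
  open HomologyData H
  open SMatrices SM
  open Solutions H SM
  open HomologyMatrices H SM

  _Normalises_ : Aut Γ → (Aut Γ → Set) → Set
  β Normalises G = ∀ α → G α → Σ (Aut Γ) λ α' → G α' × (∀ i j → (S β ⊗ S α) i j ≡ (S α' ⊗ S β) i j)

  conjEq⇒normalises : ∀ {β G} → ConjEq β G → β Normalises G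
  conjEq⇒normalises {β} {G} βGβ⁻¹≡G α α∈G with proj₁ (βGβ⁻¹≡G α) α∈G
  ... | α' , α'∈G , βα'β⁻¹≈α = α' , α'∈G , λ i j → begin
    (S β ⊗ S α) i j   ≡⟨ S-∘ₐ α β i j ⟨
    S (α ∘ₐ β) i j    ≡⟨ S-cong αβ≈βα' i j ⟩
    S (β ∘ₐ α') i j   ≡⟨ S-∘ₐ β α' i j ⟩
    (S α' ⊗ S β) i j  ∎
    where
    open ≡-Reasoning
    αβ≈βα' : (α ∘ₐ β) ≈ₐ (β ∘ₐ α')
    αβ≈βα' u = trans (sym (βα'β⁻¹≈α (Aut.perm β ⟨$⟩ʳ u)))
                     (cong (λ v → Aut.perm β ⟨$⟩ʳ (Aut.perm α' ⟨$⟩ʳ v)) (Perm.inverseˡ (Aut.perm β)))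

  idₐ-normalises : ∀ G → idₐ Normalises G
  idₐ-normalises G α α∈G = α , α∈G , λ i j → begin
    (S idₐ ⊗ S α) i j ≡⟨ ⊗-congˡ (S α) S-id i j ⟩
    (I ⊗ S α) i j     ≡⟨ ∑-δˡ i (λ t → S α t j) ⟩
    S α i j           ≡⟨ ⊗-S-id (S α) i j ⟨
    (S α ⊗ S idₐ) i j ∎
    where open ≡-Reasoning

  -- S^β = Dτ has the right inverse S^(β⁻¹), which forces every diagonal entry of D to be a unit.
  monomial-units : ∀ β (D : Mat b b) (τ : Permutation′ b) → IsDiagonal D →
    (∀ i j → S β i j ≡ (D ⊗ permMat τ) i j) → ∀ s → D s s * S (invₐ β) (τ ⟨$⟩ˡ s) s ≡ + 1
  monomial-units β D τ D-diagonal Sβ≡Dτ s = sym (begin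
    + 1                                   ≡⟨ trans (S-id s s) (δ-diag s) ⟨
    S idₐ s s                             ≡⟨ S-cong (λ u → Perm.inverseˡ (Aut.perm β)) s s ⟨
    S (invₐ β ∘ₐ β) s s                   ≡⟨ S-∘ₐ (invₐ β) β s s ⟩
    (S β ⊗ S (invₐ β)) s s                ≡⟨ ⊗-congˡ (S (invₐ β)) Sβ≡Dτ s s ⟩
    ((D ⊗ permMat τ) ⊗ S (invₐ β)) s s    ≡⟨ ⊗-assoc D (permMat τ) (S (invₐ β)) s s ⟩
    (D ⊗ (permMat τ ⊗ S (invₐ β))) s s    ≡⟨ diagonal-⊗ D-diagonal (permMat τ ⊗ S (invₐ β)) s s ⟩
    D s s * (permMat τ ⊗ S (invₐ β)) s s  ≡⟨ cong (D s s *_) (permMat-⊗ τ (S (invₐ β)) s s) ⟩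
    D s s * S (invₐ β) (τ ⟨$⟩ˡ s) s       ∎)
    where open ≡-Reasoning

  module _ (p k l : ℕ) (r : Fin l → ℕ) where
    private
      e = rExt k l r

    rExt-below : ∀ i (i<l : toℕ i ℕ.< l) → e i ≡ r (fromℕ< i<l)
    rExt-below i i<l with toℕ i <? l
    ... | yes _    = refl
    ... | no  i≮l = contradiction i<l i≮l

    rExt-above : ∀ i → ¬ toℕ i ℕ.< l → e i ≡ k
    rExt-above i i≮l with toℕ i <? l
    ... | yes i<l = contradiction i<l i≮l
    ... | no  _   = refl

    rExt-inject≤ : (l≤b : l ℕ.≤ b) → ∀ i → e (inject≤ i l≤b) ≡ r i
    rExt-inject≤ l≤b i = trans (rExt-below (inject≤ i l≤b) ι-i<l)
                               (cong r (FinP.toℕ-injective (trans (FinP.toℕ-fromℕ< ι-i<l) (FinP.toℕ-inject≤ i l≤b))))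
      where
      ι-i<l = subst (ℕ._< l) (sym (FinP.toℕ-inject≤ i l≤b)) (FinP.toℕ<n i)

    rExt-monotone : (∀ i j → i Fin.≤ j → r i ℕ.≤ r j) → (∀ i → r i ℕ.< k) →
                    ∀ i j → i Fin.≤ j → e i ℕ.≤ e j
    rExt-monotone r-mono r<k i j i≤j with toℕ i <? l | toℕ j <? l
    ... | yes i<l | yes j<l = r-mono _ _ (subst₂ ℕ._≤_ (sym (FinP.toℕ-fromℕ< i<l)) (sym (FinP.toℕ-fromℕ< j<l)) i≤j)
    ... | yes _   | no  _   = ℕP.<⇒≤ (r<k _)
    ... | no  i≮l | yes j<l = contradiction (ℕP.≤-<-trans i≤j j<l) i≮l
    ... | no  _   | no  _   = ℕP.≤-refl

    open RowSpace (p ^ k)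
    open Congruence {p ^ k}

    powers : Fin b → ℤ
    powers i = + (p ^ e i)

    -- Rows l+1 … b of diag(p^{r_i}) are p^k ≡ 0, so only the l rows of P survive.
    Pmat≅scaleRows : l ℕ.≤ b → ∀ {n} (A : Mat b n) → Pmat p l r ⊗ A ≅ scaleRows powers A
    Pmat≅scaleRows l≤b A = ≅-intro P-row∈ scaled-row∈
      where
      ι : Fin l → Fin b
      ι i = inject≤ i l≤b
      P-row : ∀ i j → (Pmat p l r ⊗ A) i j ≡ scaleRows powers A (ι i) j
      P-row i j = begin
        ∑ (λ t → δ i t * + (p ^ r i) * A t j)   ≡⟨ ∑-cong (λ t → ℤP.*-assoc (δ i t) (+ (p ^ r i)) (A t j)) ⟩
        ∑ (λ t → δ i t * (+ (p ^ r i) * A t j)) ≡⟨ ∑-δ i (ι i) (FinP.toℕ-inject≤ i l≤b) (λ t → + (p ^ r i) * A t j) ⟩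
        + (p ^ r i) * A (ι i) j                ≡⟨ cong (λ z → + (p ^ z) * A (ι i) j) (rExt-inject≤ l≤b i) ⟨
        powers (ι i) * A (ι i) j               ∎
        where open ≡-Reasoning
      P-row∈ : ∀ i → (Pmat p l r ⊗ A) i ∈span scaleRows powers A
      P-row∈ i = ∈-resp (λ j → mod-reflexive (sym (P-row i j))) (∈-row (scaleRows powers A) (ι i))
      scaled-row∈′ : ∀ t → Dec (toℕ t ℕ.< l) → scaleRows powers A t ∈span (Pmat p l r ⊗ A)
      scaled-row∈′ t (yes t<l) =
        ∈-resp (λ j → mod-reflexive (trans (P-row (fromℕ< t<l) j) (cong (λ s → scaleRows powers A s j) ι-fromℕ<)))
               (∈-row (Pmat p l r ⊗ A) (fromℕ< t<l))
        where
        ι-fromℕ< : ι (fromℕ< t<l) ≡ t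
        ι-fromℕ< = FinP.toℕ-injective (trans (FinP.toℕ-inject≤ (fromℕ< t<l) l≤b) (FinP.toℕ-fromℕ< t<l))
      scaled-row∈′ t (no t≮l) = ∈-zero λ j → subst (λ z → + (p ^ z) * A t j ≡ + 0 mod p ^ k) (sym (rExt-above t t≮l))
                                          (multiple-mod (A t j))
      scaled-row∈ : ∀ t → scaleRows powers A t ∈span (Pmat p l r ⊗ A)
      scaled-row∈ t = scaled-row∈′ t (toℕ t <? l)

    Invariant : ∀ {m} → (Aut Γ → Set) → Mat m b → Set
    Invariant G A = ∀ α → G α → A ⊗ S α ≅ A

    invariant-≅ : ∀ {G m m'} {A : Mat m b} {B : Mat m' b} → A ≅ B → Invariant G B → Invariant G A
    invariant-≅ A≅B B-invariant α α∈G = ≅-trans (≅-⊗ʳ A≅B (S α)) (≅-trans (B-invariant α α∈G) (≅-sym A≅B))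

    invariant-⊗S : ∀ {G β m} {A : Mat m b} → β Normalises G → Invariant G A → Invariant G (A ⊗ S β)
    invariant-⊗S {G} {β} {A = A} β-normalises A-invariant α α∈G with β-normalises α α∈G
    ... | α' , α'∈G , SβSα≡Sα'Sβ = ≅-trans (≅-pointwise commute) (≅-⊗ʳ (A-invariant α' α'∈G) (S β))
      where
      open ≡-Reasoning
      commute : ∀ i j → ((A ⊗ S β) ⊗ S α) i j ≡ ((A ⊗ S α') ⊗ S β) i j
      commute i j = begin
        ((A ⊗ S β) ⊗ S α) i j ≡⟨ ⊗-assoc A (S β) (S α) i j ⟩
        (A ⊗ (S β ⊗ S α)) i j ≡⟨ ∑-cong (λ t → cong (A i t *_) (SβSα≡Sα'Sβ t j)) ⟩
        (A ⊗ (S α' ⊗ S β)) i j ≡⟨ ⊗-assoc A (S α') (S β) i j ⟨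
        ((A ⊗ S α') ⊗ S β) i j ∎

    admissible-transfer : ∀ {G Q ω Q' ω'} → IsAdmissible G p k l r Q ω → Normalised p e Q' →
      (β : Aut Γ) → β Normalises G →
      Pmat p l r ⊗ Q' ⊗ permMat ω' ≅ Pmat p l r ⊗ Q ⊗ permMat ω ⊗ S β →
      IsAdmissible G p k l r Q' ω' × Isomorphic p k l r Q ω Q' ω'
    admissible-transfer {Q' = Q'} (p-prime , 1≤k , 0<l , l<b , r-mono , r<k , _ , _ , _ , _ , invariant)
                        Q'-normalised β β-normalises X≅YSβ =
      (p-prime , 1≤k , 0<l , l<b , r-mono , r<k , Q'-invertible , diagonal unitriangular , lower unitriangular , bounded
      , invariant-≅ X≅YSβ (invariant-⊗S β-normalises invariant)) , (β , X≅YSβ)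
      where
      open Normalised Q'-normalised
      open Unitriangular
      inverse = unitriangular-inverse Q' unitriangular
      Q'-invertible = proj₁ inverse , (λ i j → toDefs (mod-reflexive (proj₁ (proj₂ inverse) i j)))
                                    , (λ i j → toDefs (mod-reflexive (proj₂ (proj₂ inverse) i j)))

    admissible-normalised : ∀ {G Q ω} → IsAdmissible G p k l r Q ω → Normalised p e Q
    admissible-normalised (_ , _ , _ , _ , _ , _ , _ , Q-diagonal , Q-lower , Q-bounded , _) =
      record { unitriangular = record { diagonal = Q-diagonal ; lower = Q-lower } ; bounded = Q-bounded }

    conjugate-solution : ∀ {G Q ω} → IsAdmissible G p k l r Q ω →
      (σ : Permutation′ b) → (∀ i → e (σ ⟨$⟩ʳ i) ≡ e i) →
      IsAdmissible G p k l r (permMat σ ⊗ Q ⊗ permMat (flip σ)) (σ ·ₚ ω)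
      × Isomorphic p k l r Q ω (permMat σ ⊗ Q ⊗ permMat (flip σ)) (σ ·ₚ ω)
    conjugate-solution {G} {Q} {ω} admissible@(p-prime , _ , _ , l<b , r-mono , r<k , _) σ σ-preserves =
      admissible-transfer {G} {Q} {ω} {Q'} {σ ·ₚ ω} admissible Q'-normalised idₐ (idₐ-normalises G) rowSpaces
      where
      instance
        p≢0 : NonZero p
        p≢0 = prime⇒nonZero p-prime
      Q' = permMat σ ⊗ Q ⊗ permMat (flip σ)
      Q'-normalised : Normalised p e Q'
      Q'-normalised = normalised-resp (λ i j → sym (conjugate-entries σ Q i j))
        (normalised-conjugate (admissible-normalised {G} {Q} {ω} admissible) (rExt-monotone r-mono r<k) σ σ-preserves)
      rowSpaces : Pmat p l r ⊗ Q' ⊗ permMat (σ ·ₚ ω) ≅ Pmat p l r ⊗ Q ⊗ permMat ω ⊗ S idₐ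
      rowSpaces =
        ≅-trans (≅-⊗ʳ (Pmat≅scaleRows (ℕP.<⇒≤ l<b) Q') (permMat (σ ·ₚ ω)))
        (≅-trans (≅-pointwise (conjugate-scaleRows σ ω powers (cong (λ a → + (p ^ a)) ∘ σ-preserves) Q))
        (≅-trans (≅-permuteRows (flip σ) (scaleRows powers Q ⊗ permMat ω))
        (≅-trans (≅-⊗ʳ (≅-sym (Pmat≅scaleRows (ℕP.<⇒≤ l<b) Q)) (permMat ω))
                 (≅-pointwise (λ i j → sym (⊗-S-id (Pmat p l r ⊗ Q ⊗ permMat ω) i j))))))

    twisted-solution : ∀ {G Q ω} → IsAdmissible G p k l r Q ω →
      (β : Aut Γ) → ConjEq β G → (D : Mat b b) (τ : Permutation′ b) → IsDiagonal D →
      (∀ i j → S β i j ≡ (D ⊗ permMat τ) i j) →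
      Σ (Mat b b) λ Q' → IsAdmissible G p k l r Q' (ω ·ₚ τ) × Isomorphic p k l r Q ω Q' (ω ·ₚ τ)
    twisted-solution {G} {Q} {ω} admissible@(p-prime , _ , _ , l<b , r-mono , r<k , _) β βGβ⁻¹≡G D τ D-diagonal Sβ≡Dτ =
      Q' , admissible-transfer {G} {Q} {ω} {Q'} {ω ·ₚ τ} admissible Q'-normalised β (conjEq⇒normalises βGβ⁻¹≡G) rowSpaces
      where
      instance
        p≢0 : NonZero p
        p≢0 = prime⇒nonZero p-prime
      d w : Fin b → ℤ
      d u = D (ω ⟨$⟩ˡ u) (ω ⟨$⟩ˡ u)
      w u = S (invₐ β) (τ ⟨$⟩ˡ (ω ⟨$⟩ˡ u)) (ω ⟨$⟩ˡ u)
      wd≡1 : ∀ u → w u * d u ≡ + 1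
      wd≡1 u = trans (ℤP.*-comm (w u) (d u)) (monomial-units β D τ D-diagonal Sβ≡Dτ (ω ⟨$⟩ˡ u))
      X : Mat b b
      X i j = w i * (Q i j * d j)
      reduced = Normalisation.normalise p (p ^ k) e (rExt-monotone r-mono r<k) X
                  (rescale-unitriangular (Normalised.unitriangular (admissible-normalised {G} {Q} {ω} admissible)) w d wd≡1)
      Q' = proj₁ reduced
      Q'-normalised = proj₁ (proj₂ reduced)
      X≅QE : scaleRows powers X ≅ scaleColumns (scaleRows powers Q) d
      X≅QE = ≅-trans (≅-pointwise (λ i j → reassociate (powers i) (w i) (Q i j) (d j)))
                     (≅-rescaleRows (scaleColumns (scaleRows powers Q) d) w d (λ i → trans (ℤP.*-comm (d i) (w i)) (wd≡1 i)))
        where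
        reassociate : ∀ a c q t → a * (c * (q * t)) ≡ c * (a * q * t)
        reassociate = solve-∀
      rowSpaces : Pmat p l r ⊗ Q' ⊗ permMat (ω ·ₚ τ) ≅ Pmat p l r ⊗ Q ⊗ permMat ω ⊗ S β
      rowSpaces =
        ≅-trans (≅-⊗ʳ (Pmat≅scaleRows (ℕP.<⇒≤ l<b) Q') (permMat (ω ·ₚ τ)))
        (≅-trans (≅-⊗ʳ (proj₂ (proj₂ reduced)) (permMat (ω ·ₚ τ)))
        (≅-trans (≅-⊗ʳ X≅QE (permMat (ω ·ₚ τ)))
        (≅-trans (≅-pointwise (λ i j → sym (trans (⊗-congʳ (scaleRows powers Q ⊗ permMat ω) Sβ≡Dτ i j)
                                                   (permMat-monomial D-diagonal (scaleRows powers Q) ω τ i j))))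
                 (≅-⊗ʳ (≅-⊗ʳ (≅-sym (Pmat≅scaleRows (ℕP.<⇒≤ l<b) Q)) (permMat ω)) (S β)))))

proposition3p15 : (Γ : SimpleGraph) (H : HomologyData Γ) (SM : SMatrices Γ H) →
    let open HomologyData H
        open SMatrices SM
        open Solutions H SM
    in
    (G : Aut Γ → Set) → IsSubgroup G →
    (p k l : ℕ) (r : Fin l → ℕ) (Q : Mat b b) (ω : Permutation′ b) →
    IsAdmissible G p k l r Q ω →
    -- (a)
    ((σ : Permutation′ b) →
       (∀ i → rExt k l r (σ ⟨$⟩ʳ i) ≡ rExt k l r i) →
       IsAdmissible G p k l r (permMat σ ⊗ Q ⊗ permMat (flip σ)) (σ ·ₚ ω)
       × Isomorphic p k l r Q ω (permMat σ ⊗ Q ⊗ permMat (flip σ)) (σ ·ₚ ω))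
    ×
    -- (b)
    ((β : Aut Γ) → ConjEq β G →
       (D : Mat b b) (τ : Permutation′ b) → IsDiagonal D →
       (∀ i j → S β i j ≡ (D ⊗ permMat τ) i j) →
       Σ (Mat b b) λ Q' →
         IsAdmissible G p k l r Q' (ω ·ₚ τ)
         × Isomorphic p k l r Q ω Q' (ω ·ₚ τ))
proposition3p15 Γ H SM G _ p k l r Q ω admissible =
  conjugate-solution p k l r {G} {Q} {ω} admissible , twisted-solution p k l r {G} {Q} {ω} admissible
  where open Admissibility H SM
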